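{- Let $\Pi$ be a linear $m$-scheme on $S\subseteq V$. Then: (1) For $k\in[m]$, $\mathcal{B}(\Pi^{(k)})$ is closed under union, intersection and complement in $S^k$. (2) Let $k,k'\in[m]$ with $k+k'\le m$, and $B\in\mathcal{B}(\Pi^{(k+k')})$. Let $Q$ be one of the quantifiers $\exists$, $\forall$, or $\exists_{=t}$ ("there exist exactly $t$ elements", $t\in\mathbb{N}$), and let $B_Q$ be the set of $x\in S^k$ satisfying "$Q\,y\in S^{k'}:(x,y)\in B$". Then $B_Q\in\mathcal{B}(\Pi^{(k)})$. (3) For $k,k'\in[m]$, $B\in\mathcal{B}(\Pi^{(k)})$ and $\tau\in\mathcal{M}_{k,k'}$, $\tau(B)\cap S^{k'}\in\mathcal{B}(\Pi^{(k')})$. (4) For $k,k'\in[m]$, $B\in\mathcal{B}(\Pi^{(k')})$ and $\tau\in\mathcal{M}_{k,k'}$, $\tau^{ -1}(B)\cap S^{k}\in\mathcal{B}(\Pi^{(k)})$.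
   Context: $V$ is a finite-dimensional vector space over a finite field $\mathbb{F}$. $\mathcal{M}_{k,k'}$ is the set of maps $V^k\to V^{k'}$, $(x_1,\dots,x_k)\mapsto(\sum_i c_{i,1}x_i,\dots,\sum_i c_{i,k'}x_i)$, $c_{i,j}\in\mathbb{F}$. A linear $m$-scheme on $S$ is $\Pi=\{\Pi^{(1)},\dots,\Pi^{(m)}\}$ with $\Pi^{(k)}$ a partition of $S^k$ such that for all $k,k'\in[m]$, $B\in\Pi^{(k)}$, $B'\in\Pi^{(k')}$, $\tau\in\mathcal{M}_{k,k'}$: (P1) $\tau(B)=B'$ or $\tau(B)\cap B'=\emptyset$; (P2) $\#\{x\in B:\tau(x)=y\}$ is constant for $y\in B'$. For a set $P$ of subsets of a set $X$, $\mathcal{B}(P)$ is the set of subsets of $X$ that are unions of members of $P$. -}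

module Defs where

open import Level using (0ℓ)
open import Data.Nat using (ℕ; zero; suc; _+_; _≤_)
open import Data.Nat.Properties using (≤-trans; m≤m+n)
open import Data.Fin using (Fin)
import Data.Fin as Fin
open import Data.Bool using (Bool; true; false; _∧_)
open import Data.Vec using (Vec; []; _∷_; zipWith; map; replicate; tabulate; lookup; _++_)
open import Data.List using (List; length)
open import Data.List.Membership.Propositional using (_∈_)
open import Data.List.Relation.Unary.Unique.Propositional using (Unique)
open import Data.Product using (Σ; ∃; _×_; _,_)
open import Data.Sum using (_⊎_)
open import Relation.Binary.PropositionalEquality using (_≡_; _≢_)
open import Relation.Unary using (Pred)
open import Algebra.Structures using (IsCommutativeRing)
open import Function.Bundles using (_↔_)

record FiniteField : Set₁ where
  field
    Carrier : Set
    _+F_ : Carrier → Carrier → Carrier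
    _*F_ : Carrier → Carrier → Carrier
    -F_  : Carrier → Carrier
    0#  : Carrier
    1#  : Carrier
    isCommutativeRing : IsCommutativeRing _≡_ _+F_ _*F_ -F_ 0# 1#
    0≢1 : 0# ≢ 1#
    inverse : ∀ x → x ≢ 0# → ∃ λ y → x *F y ≡ 1#
    size : ℕ
    finite : Carrier ↔ Fin size

HasCard : {X : Set} → Pred X 0ℓ → ℕ → Set
HasCard {X} A t = Σ (List X) λ l → length l ≡ t × Unique l × (∀ x → x ∈ l → A x) × (∀ x → A x → x ∈ l)

record Partition (X : Set) (U : X → Bool) : Set where
  field
    r        : ℕ
    block    : Fin r → X → Bool
    nonempty : ∀ j → ∃ λ x → block j x ≡ true
    disjoint : ∀ i j x → block i x ≡ true → block j x ≡ true → i ≡ j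
    inside   : ∀ j x → block j x ≡ true → U x ≡ true
    cover    : ∀ x → U x ≡ true → ∃ λ j → block j x ≡ true
open Partition public

-- 𝓑(P): the sets that are unions of members of P
𝓑 : {X : Set} {U : X → Bool} → Partition X U → Pred X 0ℓ → Set
𝓑 P A = ∃ λ (J : Fin (r P) → Bool) →
  ∀ x → (A x → ∃ λ j → J j ≡ true × block P j x ≡ true)
      × ((∃ λ j → J j ≡ true × block P j x ≡ true) → A x)

module _ (F : FiniteField) (n : ℕ) where
  open FiniteField F

  V : Set
  V = Vec Carrier n

  _+ᵥ_ : V → V → V
  _+ᵥ_ = zipWith _+F_

  _•_ : Carrier → V → V
  c • v = map (c *F_) v

  0ᵥ : V
  0ᵥ = replicate n 0#

  sumV : ∀ {k} → (Fin k → V) → V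
  sumV {zero}  f = 0ᵥ
  sumV {suc k} f = f Fin.zero +ᵥ sumV (λ i → f (Fin.suc i))

  -- the map in 𝓜_{k,k'} with coefficients c i j = c_{i,j}:
  -- (x_1..x_k) ↦ (Σ_i c_{i,1} x_i, …, Σ_i c_{i,k'} x_i)
  applyM : ∀ {k k'} → (Fin k → Fin k' → Carrier) → Vec V k → Vec V k'
  applyM c x = tabulate λ j → sumV λ i → c i j • lookup x i

  pow : (V → Bool) → (k : ℕ) → Vec V k → Bool
  pow S zero    []       = true
  pow S (suc k) (v ∷ vs) = S v ∧ pow S k vs

  fibre : ∀ {k k'} → (Fin k → Fin k' → Carrier) → (Vec V k → Bool) → Vec V k' → Pred (Vec V k) 0ℓ
  fibre c B y x = B x ≡ true × applyM c x ≡ y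

  record LinearScheme (m : ℕ) (S : V → Bool) : Set where
    field
      Π : (k : ℕ) → .(1 ≤ k) → .(k ≤ m) → Partition (Vec V k) (pow S k)
      P1 : ∀ k k' .(a : 1 ≤ k) .(b : k ≤ m) .(a' : 1 ≤ k') .(b' : k' ≤ m)
             (j : Fin (r (Π k a b))) (j' : Fin (r (Π k' a' b')))
             (c : Fin k → Fin k' → Carrier) →
             -- τ(B) = B'
             (∀ y → ((∃ λ x → fibre c (block (Π k a b) j) y x) → block (Π k' a' b') j' y ≡ true)
                  × (block (Π k' a' b') j' y ≡ true → ∃ λ x → fibre c (block (Π k a b) j) y x))
             ⊎
             -- τ(B) ∩ B' = ∅
             (∀ x → block (Π k a b) j x ≡ true → block (Π k' a' b') j' (applyM c x) ≡ false)
      P2 : ∀ k k' .(a : 1 ≤ k) .(b : k ≤ m) .(a' : 1 ≤ k') .(b' : k' ≤ m)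
             (j : Fin (r (Π k a b))) (j' : Fin (r (Π k' a' b')))
             (c : Fin k → Fin k' → Carrier) →
             ∃ λ (N : ℕ) → ∀ y → block (Π k' a' b') j' y ≡ true →
               HasCard (fibre c (block (Π k a b) j) y) N
  open LinearScheme public

  image : ∀ {k k'} → (Fin k → Fin k' → Carrier) → Pred (Vec V k) 0ℓ → Pred (Vec V k') 0ℓ
  image c B y = ∃ λ x → B x × applyM c x ≡ y

  preimage : ∀ {k k'} → (Fin k → Fin k' → Carrier) → Pred (Vec V k') 0ℓ → Pred (Vec V k) 0ℓ
  preimage c B x = B (applyM c x)

  inPow : (V → Bool) → (k : ℕ) → Pred (Vec V k) 0ℓ
  inPow S k x = pow S k x ≡ true

  B∃ : (S : V → Bool) (k k' : ℕ) → Pred (Vec V (k + k')) 0ℓ → Pred (Vec V k) 0ℓ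
  B∃ S k k' B x = inPow S k x × ∃ λ y → inPow S k' y × B (x ++ y)

  B∀ : (S : V → Bool) (k k' : ℕ) → Pred (Vec V (k + k')) 0ℓ → Pred (Vec V k) 0ℓ
  B∀ S k k' B x = inPow S k x × (∀ y → inPow S k' y → B (x ++ y))

  B∃= : (S : V → Bool) (k k' : ℕ) → ℕ → Pred (Vec V (k + k')) 0ℓ → Pred (Vec V k) 0ℓ
  B∃= S k k' t B x = inPow S k x × HasCard (λ y → inPow S k' y × B (x ++ y)) t

≤-+ˡ : ∀ {k k' m : ℕ} → k + k' ≤ m → k ≤ m
≤-+ˡ {k} {k'} h = ≤-trans (m≤m+n k k') h

1≤-+ : ∀ {k k' : ℕ} → 1 ≤ k → 1 ≤ k + k'
1≤-+ {k} {k'} h = ≤-trans h (m≤m+n k k')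

{-# OPTIONS --safe #-}
module Submission where

-- A subset of S^k lies in 𝓑(Π^(k)) as soon as it is contained in S^k and, on every block of Π^(k),
-- membership in it is decided by a decidable property of the block (𝓑-blockwise). By (P1) the image
-- of a block under τ ∈ 𝓜 either equals a given block or misses it, so images and preimages of unions of
-- blocks are unions of blocks. B_∃ is the image of B under the projection (x , y) ↦ x, and B_∀ is dual
-- to it through complements. By (P2) the fibre of that projection over x inside a block of Π^(k+k') has
-- a size depending only on the block of x, so the number of y with (x , y) ∈ B, a sum of such sizes over
-- the blocks making up B, is constant on the blocks of Π^(k).

open import Algebra.Structures using (IsCommutativeRing)
open import Data.Bool using (Bool; true; false; if_then_else_)
import Data.Bool as Bool
open import Data.Empty using (⊥-elim)
open import Data.Fin using (Fin; zero; suc; _↑ˡ_)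
open import Data.Fin.Properties using (any?; suc-injective)
open import Data.List as List using ([]; _∷_)
open import Data.List.Membership.Propositional.Properties using (∈-map⁺; ∈-map⁻; ∈-++⁺ˡ; ∈-++⁺ʳ; ∈-++⁻)
open import Data.List.Membership.Propositional.Properties.WithK using (unique∧set⇒bag)
open import Data.List.Properties using (length-map; length-++)
open import Data.List.Relation.Binary.BagAndSetEquality using (∼bag⇒↭)
open import Data.List.Relation.Binary.Permutation.Propositional.Properties using (↭-length)
open import Data.List.Relation.Unary.All as All using (All; []; _∷_)
import Data.List.Relation.Unary.All.Properties as All
open import Data.List.Relation.Unary.AllPairs using ([]; _∷_)
open import Data.List.Relation.Unary.Unique.Propositional using (Unique)
import Data.List.Relation.Unary.Unique.Propositional.Properties as Unique
open import Data.Nat as ℕ using (ℕ; _+_; _≤_)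
open import Data.Nat.ListAction using (sum)
open import Data.Product using (∃; _×_; _,_; proj₁; proj₂)
open import Data.Product.Function.NonDependent.Propositional using (_×-⇔_)
open import Data.Sum using (inj₁; inj₂; [_,_]′)
open import Data.Sum.Function.Propositional using (_⊎-⇔_)
open import Data.Vec using (Vec; []; _∷_; _++_; take; drop; tabulate; lookup)
open import Data.Vec.Properties
  using (map-cong; map-id; map-const; zipWith-identityˡ; zipWith-identityʳ; tabulate-cong; tabulate∘lookup;
         lookup-++ˡ; take++drop≡id; ++-injectiveʳ)
open import Function using (_∘_; _⇔_; mk⇔; Equivalence)
import Function.Properties.Equivalence as ⇔
open import Level using (0ℓ)
open import Relation.Binary.PropositionalEquality
  using (_≡_; refl; sym; trans; cong; cong₂; subst; module ≡-Reasoning)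
open import Relation.Nullary using (¬_; Dec; yes; no; does; contradiction; ¬?; _×-dec_; _⊎-dec_)
open import Relation.Nullary.Decidable as Dec using (dec-true; decidable-stable)
open import Relation.Unary using (Pred; Decidable; Empty; _⊆_; _≐_; _∪_; _∩_; ∁)

open import Defs

open ≡-Reasoning

open Equivalence using (to; from)

does≡true⇔ : ∀ {A : Set} (a? : Dec A) → does a? ≡ true ⇔ A
does≡true⇔ (yes a) = mk⇔ (λ _ → a) (λ _ → refl)
does≡true⇔ (no ¬a) = mk⇔ (λ ()) (λ a → contradiction a ¬a)

module _ {X : Set} {U : X → Bool} (P : Partition X U) where

  InU : Pred X 0ℓ
  InU x = U x ≡ true

  𝓑-blockwise : ∀ {A : Pred X 0ℓ} {Q : Pred (Fin (r P)) 0ℓ} → Decidable Q → A ⊆ InU →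
                (∀ {j x} → block P j x ≡ true → A x ⇔ Q j) → 𝓑 P A
  𝓑-blockwise Q? A⊆U A⇔Q = (λ j → does (Q? j)) , λ x →
      (λ Ax → let j , bx = cover P x (A⊆U Ax) in j , dec-true (Q? j) (to (A⇔Q bx) Ax) , bx)
    , (λ (j , Qj , bx) → from (A⇔Q bx) (to (does≡true⇔ (Q? j)) Qj))

  𝓑-⊆ : ∀ {A : Pred X 0ℓ} → 𝓑 P A → A ⊆ InU
  𝓑-⊆ (_ , A⇔) Ax = let j , _ , bx = proj₁ (A⇔ _) Ax in inside P j _ bx

  𝓑-block : ∀ {A : Pred X 0ℓ} (A∈𝓑 : 𝓑 P A) {j x} → block P j x ≡ true → A x ⇔ proj₁ A∈𝓑 j ≡ true
  𝓑-block (J , A⇔) {j} {x} bx = mk⇔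
    (λ Ax → let i , Ji , bi = proj₁ (A⇔ x) Ax in subst (λ i → J i ≡ true) (disjoint P i j x bi bx) Ji)
    (λ Jj → proj₂ (A⇔ x) (j , Jj , bx))

  𝓑-resp-≐ : ∀ {A B : Pred X 0ℓ} → A ≐ B → 𝓑 P A → 𝓑 P B
  𝓑-resp-≐ (A⊆B , B⊆A) (J , A⇔) = J , λ x → proj₁ (A⇔ x) ∘ B⊆A , A⊆B ∘ proj₂ (A⇔ x)

  𝓑-dec : ∀ {A : Pred X 0ℓ} → 𝓑 P A → ∀ {x} → InU x → Dec (A x)
  𝓑-dec A∈𝓑 {x} ux =
    let j , bx = cover P x ux in Dec.map (⇔.sym (𝓑-block A∈𝓑 bx)) (proj₁ A∈𝓑 j Bool.≟ true)

  𝓑-∪ : ∀ {A B : Pred X 0ℓ} → 𝓑 P A → 𝓑 P B → 𝓑 P (A ∪ B)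
  𝓑-∪ A∈𝓑@(JA , _) B∈𝓑@(JB , _) =
    𝓑-blockwise (λ j → (JA j Bool.≟ true) ⊎-dec (JB j Bool.≟ true))
      [ 𝓑-⊆ A∈𝓑 , 𝓑-⊆ B∈𝓑 ]′
      (λ bx → 𝓑-block A∈𝓑 bx ⊎-⇔ 𝓑-block B∈𝓑 bx)

  𝓑-∩ : ∀ {A B : Pred X 0ℓ} → 𝓑 P A → 𝓑 P B → 𝓑 P (A ∩ B)
  𝓑-∩ A∈𝓑@(JA , _) B∈𝓑@(JB , _) =
    𝓑-blockwise (λ j → (JA j Bool.≟ true) ×-dec (JB j Bool.≟ true))
      (𝓑-⊆ A∈𝓑 ∘ proj₁)
      (λ bx → 𝓑-block A∈𝓑 bx ×-⇔ 𝓑-block B∈𝓑 bx)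

  𝓑-∁ : ∀ {A : Pred X 0ℓ} → 𝓑 P A → 𝓑 P (InU ∩ ∁ A)
  𝓑-∁ A∈𝓑@(JA , _) =
    𝓑-blockwise (λ j → ¬? (JA j Bool.≟ true)) proj₁
      (λ {j} {x} bx → mk⇔ (λ (_ , ¬Ax) → ¬Ax ∘ from (𝓑-block A∈𝓑 bx))
                         (λ ¬Jj → inside P j x bx , ¬Jj ∘ to (𝓑-block A∈𝓑 bx)))

module _ {X : Set} where

  HasCard-resp-≐ : ∀ {A B : Pred X 0ℓ} {t} → A ≐ B → HasCard A t → HasCard B t
  HasCard-resp-≐ (A⊆B , B⊆A) (l , len , uniq , ∈⇒A , A⇒∈) =
    l , len , uniq , (λ x → A⊆B ∘ ∈⇒A x) , (λ x → A⇒∈ x ∘ B⊆A)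

  HasCard-unique : ∀ {A : Pred X 0ℓ} {t t'} → HasCard A t → HasCard A t' → t ≡ t'
  HasCard-unique (l , refl , uniq , ∈⇒A , A⇒∈) (l' , refl , uniq' , ∈⇒A' , A⇒∈') =
    ↭-length (∼bag⇒↭ (unique∧set⇒bag uniq uniq'
      (mk⇔ (λ x∈l → A⇒∈' _ (∈⇒A _ x∈l)) (λ x∈l' → A⇒∈ _ (∈⇒A' _ x∈l')))))

  HasCard-∅ : ∀ {A : Pred X 0ℓ} → Empty A → HasCard A 0
  HasCard-∅ ∅ = [] , refl , [] , (λ x ()) , (λ x Ax → ⊥-elim (∅ x Ax))

  HasCard-∪ : ∀ {A B : Pred X 0ℓ} {t t'} → Empty (A ∩ B) →
              HasCard A t → HasCard B t' → HasCard (A ∪ B) (t + t')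
  HasCard-∪ ∅ (l , refl , uniq , ∈⇒A , A⇒∈) (l' , refl , uniq' , ∈⇒B , B⇒∈) =
    l List.++ l' , length-++ l ,
    Unique.++⁺ uniq uniq' (λ (x∈l , x∈l') → ∅ _ (∈⇒A _ x∈l , ∈⇒B _ x∈l')) ,
    (λ x x∈ → [ inj₁ ∘ ∈⇒A x , inj₂ ∘ ∈⇒B x ]′ (∈-++⁻ l x∈)) ,
    (λ x → [ ∈-++⁺ˡ ∘ A⇒∈ x , ∈-++⁺ʳ l ∘ B⇒∈ x ]′)

  HasCard-⋃ : ∀ {r} (A : Fin r → Pred X 0ℓ) (t : Fin r → ℕ) → (∀ i → HasCard (A i) (t i)) →
              (∀ {i i' x} → A i x → A i' x → i ≡ i') →
              HasCard (λ x → ∃ λ i → A i x) (sum (List.tabulate t))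
  HasCard-⋃ {ℕ.zero} _ _ _ _ = HasCard-∅ λ _ ()
  HasCard-⋃ {ℕ.suc r} A t card disj =
    HasCard-resp-≐
      ( [ (zero ,_) , (λ (i , Ax) → suc i , Ax) ]′
      , λ { (zero , Ax) → inj₁ Ax ; (suc i , Ax) → inj₂ (i , Ax) })
      (HasCard-∪ (λ x (A₀x , i , Aᵢx) → zero≢suc (disj A₀x Aᵢx)) (card zero)
        (HasCard-⋃ (A ∘ suc) (t ∘ suc) (card ∘ suc) (λ Ax Ax' → suc-injective (disj Ax Ax'))))
    where
    zero≢suc : ∀ {i : Fin r} → ¬ zero ≡ suc i
    zero≢suc ()

module _ {X Y : Set} where

  HasCard-image : ∀ {A : Pred X 0ℓ} {t} (f : X → Y) → (∀ {x x'} → A x → A x' → f x ≡ f x' → x ≡ x') →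
                  HasCard A t → HasCard (λ y → ∃ λ x → A x × f x ≡ y) t
  HasCard-image {A} f inj (l , refl , uniq , ∈⇒A , A⇒∈) =
    List.map f l , length-map f l , map-unique uniq (All.tabulate (∈⇒A _)) ,
    (λ y y∈ → let x , x∈l , y≡fx = ∈-map⁻ f y∈ in x , ∈⇒A x x∈l , sym y≡fx) ,
    (λ { y (x , Ax , refl) → ∈-map⁺ f (A⇒∈ x Ax) })
    where
    map-unique : ∀ {xs} → Unique xs → All A xs → Unique (List.map f xs)
    map-unique [] [] = []
    map-unique (x∉xs ∷ uniq) (Ax ∷ Axs) =
      All.map⁺ (All.zipWith (λ (x≢x' , Ax') fx≡fx' → x≢x' (inj Ax Ax' fx≡fx')) (x∉xs , Axs))
      ∷ map-unique uniq Axs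

drop-++ : ∀ {A : Set} k {k'} (x : Vec A k) (y : Vec A k') → drop k (x ++ y) ≡ y
drop-++ k x y = sym (++-injectiveʳ x (take k (x ++ y)) (sym (take++drop≡id k (x ++ y))))

module _ (F : FiniteField) (n : ℕ) where
  open FiniteField F
  open IsCommutativeRing isCommutativeRing using (*-identityˡ; zeroˡ; +-identityˡ; +-identityʳ)

  δ : ∀ {k} → Fin k → Fin k → Carrier
  δ zero    zero    = 1#
  δ zero    (suc _) = 0#
  δ (suc _) zero    = 0#
  δ (suc i) (suc j) = δ i j

  •-identityˡ : (v : V F n) → _•_ F n 1# v ≡ v
  •-identityˡ v = trans (map-cong *-identityˡ v) (map-id v)

  •-zeroˡ : (v : V F n) → _•_ F n 0# v ≡ 0ᵥ F n
  •-zeroˡ v = trans (map-cong zeroˡ v) (map-const v 0#)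

  sumV-zero : ∀ {k} (f : Fin k → V F n) → (∀ i → f i ≡ 0ᵥ F n) → sumV F n f ≡ 0ᵥ F n
  sumV-zero {ℕ.zero}  f f≡0 = refl
  sumV-zero {ℕ.suc k} f f≡0 = begin
    _+ᵥ_ F n (f zero) (sumV F n (f ∘ suc))
      ≡⟨ cong₂ (_+ᵥ_ F n) (f≡0 zero) (sumV-zero (f ∘ suc) (f≡0 ∘ suc)) ⟩
    _+ᵥ_ F n (0ᵥ F n) (0ᵥ F n)
      ≡⟨ zipWith-identityˡ +-identityˡ (0ᵥ F n) ⟩
    0ᵥ F n ∎

  sumV-δ : ∀ {k} (z : Vec (V F n) k) (i₀ : Fin k) →
           sumV F n (λ i → _•_ F n (δ i i₀) (lookup z i)) ≡ lookup z i₀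
  sumV-δ (z₀ ∷ z) zero = begin
    _+ᵥ_ F n (_•_ F n 1# z₀) (sumV F n (λ i → _•_ F n 0# (lookup z i)))
      ≡⟨ cong₂ (_+ᵥ_ F n) (•-identityˡ z₀) (sumV-zero _ (•-zeroˡ ∘ lookup z)) ⟩
    _+ᵥ_ F n z₀ (0ᵥ F n)
      ≡⟨ zipWith-identityʳ +-identityʳ z₀ ⟩
    z₀ ∎
  sumV-δ (z₀ ∷ z) (suc i₀) = begin
    _+ᵥ_ F n (_•_ F n 0# z₀) (sumV F n (λ i → _•_ F n (δ i i₀) (lookup z i)))
      ≡⟨ cong₂ (_+ᵥ_ F n) (•-zeroˡ z₀) (sumV-δ z i₀) ⟩
    _+ᵥ_ F n (0ᵥ F n) (lookup z i₀)
      ≡⟨ zipWith-identityˡ +-identityˡ (lookup z i₀) ⟩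
    lookup z i₀ ∎

  -- the coefficients of the projection (x , y) ↦ x of V^(k+k') onto V^k
  firstCoordinates : ∀ k k' → Fin (k + k') → Fin k → Carrier
  firstCoordinates k k' i j = δ i (j ↑ˡ k')

  applyM-firstCoordinates : ∀ {k k'} (x : Vec (V F n) k) (y : Vec (V F n) k') →
                            applyM F n (firstCoordinates k k') (x ++ y) ≡ x
  applyM-firstCoordinates {k} {k'} x y = begin
    tabulate (λ j → sumV F n (λ i → _•_ F n (δ i (j ↑ˡ k')) (lookup (x ++ y) i)))
      ≡⟨ tabulate-cong (λ j → trans (sumV-δ (x ++ y) (j ↑ˡ k')) (lookup-++ˡ x y j)) ⟩
    tabulate (lookup x)
      ≡⟨ tabulate∘lookup x ⟩
    x ∎

  firstCoordinates-fibre : ∀ {k k'} {x : Vec (V F n) k} (z : Vec (V F n) (k + k')) →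
                           applyM F n (firstCoordinates k k') z ≡ x → z ≡ x ++ drop k z
  firstCoordinates-fibre {k} {k'} z refl = begin
    z
      ≡⟨ sym (take++drop≡id k z) ⟩
    take k z ++ drop k z
      ≡⟨ cong (_++ drop k z) (sym (applyM-firstCoordinates (take k z) (drop k z))) ⟩
    applyM F n (firstCoordinates k k') (take k z ++ drop k z) ++ drop k z
      ≡⟨ cong (λ w → applyM F n (firstCoordinates k k') w ++ drop k z) (take++drop≡id k z) ⟩
    applyM F n (firstCoordinates k k') z ++ drop k z ∎

  fibre-firstCoordinates : ∀ {k k'} (C : Vec (V F n) (k + k') → Bool) (x : Vec (V F n) k) {t} →
                           HasCard (fibre F n (firstCoordinates k k') C x) t →
                           HasCard (λ y → C (x ++ y) ≡ true) t
  fibre-firstCoordinates {k} {k'} C x card =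
    HasCard-resp-≐ (image⊆ , ⊆image) (HasCard-image (drop k) drop-injective card)
    where
    Fibre : Pred (Vec (V F n) (k + k')) 0ℓ
    Fibre = fibre F n (firstCoordinates k k') C x
    drop-injective : ∀ {z z'} → Fibre z → Fibre z' → drop k z ≡ drop k z' → z ≡ z'
    drop-injective {z} {z'} (_ , πz) (_ , πz') eq =
      trans (firstCoordinates-fibre z πz) (trans (cong (x ++_) eq) (sym (firstCoordinates-fibre z' πz')))
    image⊆ : (λ y → ∃ λ z → Fibre z × drop k z ≡ y) ⊆ (λ y → C (x ++ y) ≡ true)
    image⊆ (z , (Cz , πz) , refl) = subst (λ w → C w ≡ true) (firstCoordinates-fibre z πz) Cz
    ⊆image : (λ y → C (x ++ y) ≡ true) ⊆ (λ y → ∃ λ z → Fibre z × drop k z ≡ y)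
    ⊆image {y} Cxy = x ++ y , (Cxy , applyM-firstCoordinates x y) , drop-++ k x y

module _ (F : FiniteField) (n : ℕ) (S : V F n → Bool) where

  inPow-++ : ∀ {k k'} (x : Vec (V F n) k) (y : Vec (V F n) k') →
             inPow F n S (k + k') (x ++ y) ⇔ (inPow F n S k x × inPow F n S k' y)
  inPow-++ []      y = mk⇔ (refl ,_) proj₂
  inPow-++ (v ∷ x) y with S v
  ... | true  = inPow-++ x y
  ... | false = mk⇔ (λ ()) (λ { (() , _) })

  image-firstCoordinates≐B∃ : ∀ {k k'} {B : Pred (Vec (V F n) (k + k')) 0ℓ} → B ⊆ inPow F n S (k + k') →
                              image F n (firstCoordinates F n k k') B ∩ inPow F n S k ≐ B∃ F n S k k' B
  image-firstCoordinates≐B∃ {k} {k'} {B} B⊆Sᵏ⁺ᵏ' = image⊆B∃ , B∃⊆image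
    where
    image⊆B∃ : image F n (firstCoordinates F n k k') B ∩ inPow F n S k ⊆ B∃ F n S k k' B
    image⊆B∃ {x} ((z , Bz , πz≡x) , Sᵏx) =
      Sᵏx , drop k z , proj₂ (to (inPow-++ x (drop k z)) (subst (inPow F n S _) z≡xy (B⊆Sᵏ⁺ᵏ' Bz))) ,
      subst B z≡xy Bz
      where
      z≡xy : z ≡ x ++ drop k z
      z≡xy = firstCoordinates-fibre F n z πz≡x
    B∃⊆image : B∃ F n S k k' B ⊆ image F n (firstCoordinates F n k k') B ∩ inPow F n S k
    B∃⊆image {x} (Sᵏx , y , _ , Bxy) = (x ++ y , Bxy , applyM-firstCoordinates F n x y) , Sᵏx

  ∁B∃∁≐B∀ : ∀ {k k'} {B : Pred (Vec (V F n) (k + k')) 0ℓ} →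
            (∀ {z} → inPow F n S (k + k') z → Dec (B z)) →
            inPow F n S k ∩ ∁ (B∃ F n S k k' (inPow F n S (k + k') ∩ ∁ B)) ≐ B∀ F n S k k' B
  ∁B∃∁≐B∀ B? =
      (λ {x} (Sᵏx , ¬∃) → Sᵏx , λ y Sᵏ'y →
         let Sxy = from (inPow-++ x y) (Sᵏx , Sᵏ'y) in
         decidable-stable (B? Sxy) (λ ¬Bxy → ¬∃ (Sᵏx , y , Sᵏ'y , Sxy , ¬Bxy)))
    , (λ (Sᵏx , ∀B) → Sᵏx , λ (_ , y , Sᵏ'y , _ , ¬Bxy) → ¬Bxy (∀B y Sᵏ'y))

module _ (F : FiniteField) (n m : ℕ) (S : V F n → Bool) (Π : LinearScheme F n m S) where
  open FiniteField F using (Carrier)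

  Part : (k : ℕ) → .(1 ≤ k) → .(k ≤ m) → Partition (Vec (V F n) k) (pow F n S k)
  Part = LinearScheme.Π Π

  module _ {k k'} .(a : 1 ≤ k) .(b : k ≤ m) .(a' : 1 ≤ k') .(b' : k' ≤ m)
           (c : Fin k → Fin k' → Carrier) where

    Meets : Fin (r (Part k a b)) → Fin (r (Part k' a' b')) → Set
    Meets j j' = ∃ λ x → block (Part k a b) j x ≡ true × block (Part k' a' b') j' (applyM F n c x) ≡ true

    disjoint⇒¬Meets : ∀ {j j'} →
                      (∀ x → block (Part k a b) j x ≡ true → block (Part k' a' b') j' (applyM F n c x) ≡ false) →
                      ¬ Meets j j'
    disjoint⇒¬Meets τB∩B'≡∅ (x , bx , b'τx) = contradiction (trans (sym b'τx) (τB∩B'≡∅ x bx)) λ ()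

    meets⇒τ[B]≐B' : ∀ {j j'} → Meets j j' → ∀ y →
                    ((∃ λ x → fibre F n c (block (Part k a b) j) y x) → block (Part k' a' b') j' y ≡ true)
                    × (block (Part k' a' b') j' y ≡ true → ∃ λ x → fibre F n c (block (Part k a b) j) y x)
    meets⇒τ[B]≐B' {j} {j'} meets with P1 Π k k' a b a' b' j j' c
    ... | inj₁ τB≐B'   = τB≐B'
    ... | inj₂ τB∩B'≡∅ = contradiction meets (disjoint⇒¬Meets τB∩B'≡∅)

    meets? : ∀ j j' → Dec (Meets j j')
    meets? j j' with P1 Π k k' a b a' b' j j' c
    ... | inj₁ τB≐B' = let y , b'y = nonempty (Part k' a' b') j'
                           x , bx , τx≡y = proj₂ (τB≐B' y) b'y
                       in yes (x , bx , subst (λ y → block (Part k' a' b') j' y ≡ true) (sym τx≡y) b'y)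
    ... | inj₂ τB∩B'≡∅ = no (disjoint⇒¬Meets τB∩B'≡∅)

    𝓑-image : ∀ {B} → 𝓑 (Part k a b) B → 𝓑 (Part k' a' b') (image F n c B ∩ inPow F n S k')
    𝓑-image {B} B∈𝓑@(J , _) =
      𝓑-blockwise (Part k' a' b') (λ j' → any? λ j → (J j Bool.≟ true) ×-dec meets? j j') proj₂ image⇔
      where
      image⇔ : ∀ {j' y} → block (Part k' a' b') j' y ≡ true →
               (image F n c B ∩ inPow F n S k') y ⇔ (∃ λ j → J j ≡ true × Meets j j')
      image⇔ {j'} {y} b'y = mk⇔
        (λ { ((x , Bx , refl) , _) →
               let j , bx = cover (Part k a b) x (𝓑-⊆ (Part k a b) B∈𝓑 Bx)
               in j , to (𝓑-block (Part k a b) B∈𝓑 bx) Bx , x , bx , b'y })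
        (λ (j , Jj , meets) →
           let x , bx , τx≡y = proj₂ (meets⇒τ[B]≐B' meets y) b'y
           in (x , from (𝓑-block (Part k a b) B∈𝓑 bx) Jj , τx≡y) , inside (Part k' a' b') j' y b'y)

    𝓑-preimage : ∀ {B} → 𝓑 (Part k' a' b') B → 𝓑 (Part k a b) (preimage F n c B ∩ inPow F n S k)
    𝓑-preimage {B} B∈𝓑@(J , _) =
      𝓑-blockwise (Part k a b) (λ j → any? λ j' → (J j' Bool.≟ true) ×-dec meets? j j') proj₂ preimage⇔
      where
      preimage⇔ : ∀ {j x} → block (Part k a b) j x ≡ true →
                  (preimage F n c B ∩ inPow F n S k) x ⇔ (∃ λ j' → J j' ≡ true × Meets j j')
      preimage⇔ {j} {x} bx = mk⇔
        (λ (Bτx , _) →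
           let j' , b'τx = cover (Part k' a' b') _ (𝓑-⊆ (Part k' a' b') B∈𝓑 Bτx)
           in j' , to (𝓑-block (Part k' a' b') B∈𝓑 b'τx) Bτx , x , bx , b'τx)
        (λ (j' , J'j , meets) →
           let b'τx = proj₁ (meets⇒τ[B]≐B' meets _) (x , bx , refl)
           in from (𝓑-block (Part k' a' b') B∈𝓑 b'τx) J'j , inside (Part k a b) j x bx)

  module _ {k k'} .(a : 1 ≤ k) .(h : k + k' ≤ m) {B : Pred (Vec (V F n) (k + k')) 0ℓ}
           (B∈𝓑 : 𝓑 (Part (k + k') (1≤-+ a) h) B) where

    𝓑-B∃ : 𝓑 (Part k a (≤-+ˡ h)) (B∃ F n S k k' B)
    𝓑-B∃ = 𝓑-resp-≐ (Part k a (≤-+ˡ h))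
      (image-firstCoordinates≐B∃ F n S (𝓑-⊆ (Part (k + k') (1≤-+ a) h) B∈𝓑))
      (𝓑-image (1≤-+ a) h a (≤-+ˡ h) (firstCoordinates F n k k') B∈𝓑)

    private
      P : Partition (Vec (V F n) (k + k')) (pow F n S (k + k'))
      P = Part (k + k') (1≤-+ a) h
      Q : Partition (Vec (V F n) k) (pow F n S k)
      Q = Part k a (≤-+ˡ h)
      J : Fin (r P) → Bool
      J = proj₁ B∈𝓑

    -- (P2): the projection's fibre inside block j'' of P over any x in block j of Q has this size
    fibreSize : Fin (r P) → Fin (r Q) → ℕ
    fibreSize j'' j = proj₁ (P2 Π (k + k') k (1≤-+ a) h a (≤-+ˡ h) j'' j (firstCoordinates F n k k'))

    sliceSize : Fin (r Q) → ℕ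
    sliceSize j = sum (List.tabulate λ j'' → if J j'' then fibreSize j'' j else 0)

    slice-card : ∀ {j x} → block Q j x ≡ true → HasCard (λ y → inPow F n S k' y × B (x ++ y)) (sliceSize j)
    slice-card {j} {x} bx =
      HasCard-resp-≐ (⋃⊆slice , slice⊆⋃)
        (HasCard-⋃ (λ j'' y → J j'' ≡ true × block P j'' (x ++ y) ≡ true) _ piece-card
                   (λ (_ , bxy) (_ , bxy') → disjoint P _ _ _ bxy bxy'))
      where
      piece-card : ∀ j'' → HasCard (λ y → J j'' ≡ true × block P j'' (x ++ y) ≡ true)
                                   (if J j'' then fibreSize j'' j else 0)
      piece-card j'' with J j''
      ... | false = HasCard-∅ λ { _ (() , _) }
      ... | true  = HasCard-resp-≐ ((refl ,_) , proj₂)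
        (fibre-firstCoordinates F n (block P j'') x
          (proj₂ (P2 Π (k + k') k (1≤-+ a) h a (≤-+ˡ h) j'' j (firstCoordinates F n k k')) x bx))
      ⋃⊆slice : (λ y → ∃ λ j'' → J j'' ≡ true × block P j'' (x ++ y) ≡ true) ⊆
                (λ y → inPow F n S k' y × B (x ++ y))
      ⋃⊆slice {y} (j'' , Jj'' , bxy) =
        proj₂ (to (inPow-++ F n S x y) (inside P j'' _ bxy)) , from (𝓑-block P B∈𝓑 bxy) Jj''
      slice⊆⋃ : (λ y → inPow F n S k' y × B (x ++ y)) ⊆
                (λ y → ∃ λ j'' → J j'' ≡ true × block P j'' (x ++ y) ≡ true)
      slice⊆⋃ (_ , Bxy) =
        let j'' , bxy = cover P _ (𝓑-⊆ P B∈𝓑 Bxy) in j'' , to (𝓑-block P B∈𝓑 bxy) Bxy , bxy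

    𝓑-B∃= : ∀ t → 𝓑 Q (B∃= F n S k k' t B)
    𝓑-B∃= t = 𝓑-blockwise Q (λ j → sliceSize j ℕ.≟ t) proj₁ λ {j} {x} bx → mk⇔
      (λ (_ , card) → HasCard-unique (slice-card bx) card)
      (λ size≡t → inside Q j x bx , subst (HasCard _) size≡t (slice-card bx))

  𝓑-B∀ : ∀ {k k'} .(a : 1 ≤ k) .(h : k + k' ≤ m) {B : Pred (Vec (V F n) (k + k')) 0ℓ} →
         𝓑 (Part (k + k') (1≤-+ a) h) B → 𝓑 (Part k a (≤-+ˡ h)) (B∀ F n S k k' B)
  𝓑-B∀ a h B∈𝓑 = 𝓑-resp-≐ (Part _ a (≤-+ˡ h))
    (∁B∃∁≐B∀ F n S (𝓑-dec (Part _ (1≤-+ a) h) B∈𝓑))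
    (𝓑-∁ (Part _ a (≤-+ˡ h)) (𝓑-B∃ a h (𝓑-∁ (Part _ (1≤-+ a) h) B∈𝓑)))

lemma3p4 : (F : FiniteField) (n m : ℕ) (S : V F n → Bool) (Π : LinearScheme F n m S) →
    -- (1) closure under union, intersection, complement in S^k
    (∀ k .(a : 1 ≤ k) .(b : k ≤ m) (A B : Pred (Vec (V F n) k) 0ℓ) →
      𝓑 (LinearScheme.Π Π k a b) A → 𝓑 (LinearScheme.Π Π k a b) B →
      𝓑 (LinearScheme.Π Π k a b) (A ∪ B)
      × 𝓑 (LinearScheme.Π Π k a b) (A ∩ B)
      × 𝓑 (LinearScheme.Π Π k a b) (inPow F n S k ∩ ∁ A))
    ×
    -- (2) quantifier elimination
    (∀ k k' .(a : 1 ≤ k) .(a' : 1 ≤ k') .(h : k + k' ≤ m) (B : Pred (Vec (V F n) (k + k')) 0ℓ) →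
      𝓑 (LinearScheme.Π Π (k + k') (1≤-+ a) h) B →
      𝓑 (LinearScheme.Π Π k a (≤-+ˡ h)) (B∃ F n S k k' B)
      × 𝓑 (LinearScheme.Π Π k a (≤-+ˡ h)) (B∀ F n S k k' B)
      × (∀ (t : ℕ) → 𝓑 (LinearScheme.Π Π k a (≤-+ˡ h)) (B∃= F n S k k' t B)))
    ×
    -- (3) images
    (∀ k k' .(a : 1 ≤ k) .(b : k ≤ m) .(a' : 1 ≤ k') .(b' : k' ≤ m)
      (B : Pred (Vec (V F n) k) 0ℓ) (c : Fin k → Fin k' → FiniteField.Carrier F) →
      𝓑 (LinearScheme.Π Π k a b) B →
      𝓑 (LinearScheme.Π Π k' a' b') (image F n c B ∩ inPow F n S k'))
    ×
    -- (4) preimages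
    (∀ k k' .(a : 1 ≤ k) .(b : k ≤ m) .(a' : 1 ≤ k') .(b' : k' ≤ m)
      (B : Pred (Vec (V F n) k') 0ℓ) (c : Fin k → Fin k' → FiniteField.Carrier F) →
      𝓑 (LinearScheme.Π Π k' a' b') B →
      𝓑 (LinearScheme.Π Π k a b) (preimage F n c B ∩ inPow F n S k))
lemma3p4 F n m S Π =
    (λ k a b A B A∈𝓑 B∈𝓑 → 𝓑-∪ (Part F n m S Π k a b) A∈𝓑 B∈𝓑
                          , 𝓑-∩ (Part F n m S Π k a b) A∈𝓑 B∈𝓑
                          , 𝓑-∁ (Part F n m S Π k a b) A∈𝓑)
  , (λ k k' a a' h B B∈𝓑 → 𝓑-B∃ F n m S Π a h B∈𝓑
                          , 𝓑-B∀ F n m S Π a h B∈𝓑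
                          , 𝓑-B∃= F n m S Π a h B∈𝓑)
  , (λ k k' a b a' b' B c → 𝓑-image F n m S Π a b a' b' c)
  , (λ k k' a b a' b' B c → 𝓑-preimage F n m S Π a b a' b' c)
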